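{- Let $d$ be a positive integer, let $E_{p\to q}$ be an oriented $d$-minimal segment from $p$ to $q$, and let $g\in G$, $g(x)=Ux+v$. Then $g(E)$, oriented from $g(p)$ to $g(q)$, satisfies $W(E_{p \to q}) = \pm W(g(E)_{g(p) \to g(q)})$. Precisely, if $\det U = 1$ then $W(E_{p \to q}) = W(g(E)_{g(p) \to g(q)})$, and if $\det U=-1$ then $W(E_{p \to q}) = -W(g(E)_{g(p) \to g(q)})$ (as residues modulo $d$).
   Context: $\mathcal{L}_d = \frac{1}{d}\mathbb{Z}\times\frac{1}{d}\mathbb{Z}$. A segment $E$ with endpoints in $\mathcal{L}_d$ is a $d$-minimal segment if $E\cap\mathcal{L}_d$ consists exactly of its two endpoints. $G = GL_2(\mathbb{Z}) \ltimes \mathbb{Z}^2$ acts on $\mathbb{R}^2$ by $x\mapsto Ux+v$. For an oriented $d$-minimal segment $E_{p\to q}$ with $p=(w/d,x/d)$, $q=(y/d,z/d)$ ($w,x,y,z\in\mathbb{Z}$), its weight is $W(E_{p\to q}) = \det\begin{pmatrix} w & y\\ x & z\end{pmatrix} = wz-xy \bmod d$, an element of $\mathbb{Z}/d\mathbb{Z}$. -}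

module Defs where

open import Data.Nat as ℕ using (ℕ)
open import Data.Integer using (ℤ; +_; _+_; _-_; _*_; -_)
open import Data.Integer.Divisibility using (_∣_)
open import Data.Product using (_×_; _,_; ∃-syntax)
open import Data.Sum using (_⊎_)
open import Relation.Binary.PropositionalEquality using (_≡_)
open import Relation.Nullary using (¬_)

-- A point of L_d = (1/d)ℤ × (1/d)ℤ is represented by its pair of integer
-- numerators: (w , x) stands for the point (w/d , x/d).  For fixed d this is
-- a bijection ℤ² ≅ L_d.
Pt : Set
Pt = ℤ × ℤ

record Mat2 : Set where
  constructor mat
  field
    a b c e : ℤ

det : Mat2 → ℤ
det (mat a b c e) = a * e - b * c

InGL2 : Mat2 → Set
InGL2 U = (det U ≡ + 1) ⊎ (det U ≡ - (+ 1))

-- The affine map g(x) = U x + v  (U ∈ GL₂(ℤ), v ∈ ℤ²) acting on the point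
-- P/d of L_d, expressed on numerators:  g(P/d) = (U P + d v)/d.
act : ℕ → Mat2 → ℤ × ℤ → Pt → Pt
act d (mat a b c e) (v₁ , v₂) (w , x) =
  (a * w + b * x + (+ d) * v₁) , (c * w + e * x + (+ d) * v₂)

-- r lies on the closed segment [p , q]: r = p + t (q - p) for some t ∈ [0,1].
-- (Since p, q, r are lattice points and p ≠ q, t is necessarily rational,
-- t = m/(n+m); we write this as (n+m) r = n p + m q with n + m ≠ 0.)
-- Coordinates are numerators; the common factor 1/d cancels.
OnSeg : Pt → Pt → Pt → Set
OnSeg (w , x) (y , z) (r₁ , r₂) =
  ∃[ n ] ∃[ m ] (¬ (n ℕ.+ m ≡ 0)
    × ((+ (n ℕ.+ m)) * r₁ ≡ (+ n) * w + (+ m) * y)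
    × ((+ (n ℕ.+ m)) * r₂ ≡ (+ n) * x + (+ m) * z))

DMinimal : ℕ → Pt → Pt → Set
DMinimal d p q = ¬ (p ≡ q) × (∀ r → OnSeg p q r → (r ≡ p) ⊎ (r ≡ q))

-- Weight of the oriented segment p/d → q/d, p = (w,x), q = (y,z):
-- det (w y ; x z) = w z - x y, as an integer (to be read modulo d).
W : Pt → Pt → ℤ
W (w , x) (y , z) = w * z - x * y

_≡_[mod_] : ℤ → ℤ → ℕ → Set
a ≡ b [mod d ] = (+ d) ∣ (a - b)

-- On numerators g acts by P ↦ U P + d v, and W is the alternating bilinear
-- form (P , Q) ↦ det (P Q).  The linear part therefore multiplies W by det U
-- (multiplicativity of det), while the translation by d v only adds
-- d (W (U p) v + W v (U q)), since W (v , v) = 0.  Hence the weight of g(E)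
-- is det U · W(E) modulo d, with det U = ±1.
module Submission where

open import Defs
open import Data.Nat using (ℕ; _<_)
open import Data.Integer using (ℤ; +_; -_; _+_; _-_; _*_)
open import Data.Integer.Divisibility.Signed using (divides; ∣⇒∣ᵤ)
open import Data.Integer.Tactic.RingSolver using (solve-∀)
open import Data.Product using (_×_; _,_)
open import Data.Sum using (_⊎_; map)
open import Relation.Binary.PropositionalEquality
  using (_≡_; refl; cong; cong₂; subst; module ≡-Reasoning)

infixr 7 _·_

_·_ : Mat2 → Pt → Pt
mat a b c e · (w , x) = (a * w + b * x) , (c * w + e * x)

translate : ℤ → ℤ × ℤ → Pt → Pt
translate D (v₁ , v₂) (w , x) = (w + D * v₁) , (x + D * v₂)

act≡translate∘· : ∀ d U v p → act d U v p ≡ translate (+ d) v (U · p)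
act≡translate∘· d (mat a b c e) (v₁ , v₂) (w , x) = refl

W-· : ∀ U p q → W (U · p) (U · q) ≡ det U * W p q
W-· (mat a b c e) (w , x) (y , z) = binet a b c e w x y z
  where
  binet : ∀ a b c e w x y z →
    (a * w + b * x) * (c * y + e * z) - (c * w + e * x) * (a * y + b * z)
      ≡ (a * e - b * c) * (w * z - x * y)
  binet = solve-∀

W-translate : ∀ D t p q →
  W (translate D t p) (translate D t q) ≡ W p q + D * (W p t + W t q)
W-translate D (t₁ , t₂) (w , x) (y , z) = bilinear D t₁ t₂ w x y z
  where
  bilinear : ∀ D t₁ t₂ w x y z →
    (w + D * t₁) * (z + D * t₂) - (x + D * t₂) * (y + D * t₁)
      ≡ (w * z - x * y) + D * ((w * t₂ - x * t₁) + (t₁ * z - t₂ * y))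
  bilinear = solve-∀

W-act : ∀ d U v p q →
  W (act d U v p) (act d U v q) ≡ det U * W p q + + d * (W (U · p) v + W v (U · q))
W-act d U v p q = begin
  W (act d U v p) (act d U v q)
    ≡⟨ cong₂ W (act≡translate∘· d U v p) (act≡translate∘· d U v q) ⟩
  W (translate (+ d) v (U · p)) (translate (+ d) v (U · q))
    ≡⟨ W-translate (+ d) v (U · p) (U · q) ⟩
  W (U · p) (U · q) + + d * (W (U · p) v + W v (U · q))
    ≡⟨ cong (_+ + d * (W (U · p) v + W v (U · q))) (W-· U p q) ⟩
  det U * W p q + + d * (W (U · p) v + W v (U · q))
    ∎
  where open ≡-Reasoning

b≡1*a+dk⇒a≡b : ∀ d {a b} k → b ≡ + 1 * a + + d * k → a ≡ b [mod d ]
b≡1*a+dk⇒a≡b d {a} {b} k b≡ = ∣⇒∣ᵤ (divides (- k) (begin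
  a - b                     ≡⟨ cong (λ b′ → a - b′) b≡ ⟩
  a - (+ 1 * a + + d * k)   ≡⟨ difference a (+ d) k ⟩
  - k * + d                 ∎))
  where
  open ≡-Reasoning
  difference : ∀ a D k → a - (+ 1 * a + D * k) ≡ - k * D
  difference = solve-∀

b≡-1*a+dk⇒a≡-b : ∀ d {a b} k → b ≡ - (+ 1) * a + + d * k → a ≡ - b [mod d ]
b≡-1*a+dk⇒a≡-b d {a} {b} k b≡ = ∣⇒∣ᵤ (divides k (begin
  a - - b                          ≡⟨ cong (λ b′ → a - - b′) b≡ ⟩
  a - - (- (+ 1) * a + + d * k)    ≡⟨ sum a (+ d) k ⟩
  k * + d                          ∎))
  where
  open ≡-Reasoning
  sum : ∀ a D k → a - - (- (+ 1) * a + D * k) ≡ k * D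
  sum = solve-∀

mainTheorem5 : (d : ℕ) → 0 < d → (p q : Pt) → DMinimal d p q →
    (U : Mat2) → InGL2 U → (v : ℤ × ℤ) →
    ((W p q ≡ W (act d U v p) (act d U v q) [mod d ])
    ⊎ (W p q ≡ - W (act d U v p) (act d U v q) [mod d ]))
    × (det U ≡ + 1 → W p q ≡ W (act d U v p) (act d U v q) [mod d ])
    × (det U ≡ - (+ 1) → W p q ≡ - W (act d U v p) (act d U v q) [mod d ])
mainTheorem5 d _ p q _ U det≡±1 v =
  map preserving reversing det≡±1 , preserving , reversing
  where
  W′ : ℤ
  W′ = W (act d U v p) (act d U v q)
  K : ℤ
  K = W (U · p) v + W v (U · q)

  W′≡_*W+dK : ℤ → Set
  W′≡ t *W+dK = W′ ≡ t * W p q + + d * K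

  preserving : det U ≡ + 1 → W p q ≡ W′ [mod d ]
  preserving det≡1 =
    b≡1*a+dk⇒a≡b d {W p q} K (subst W′≡_*W+dK det≡1 (W-act d U v p q))

  reversing : det U ≡ - (+ 1) → W p q ≡ - W′ [mod d ]
  reversing det≡-1 =
    b≡-1*a+dk⇒a≡-b d {W p q} K (subst W′≡_*W+dK det≡-1 (W-act d U v p q))
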